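{- Let $\mathcal{X}$ be an $n$-premaniplex and $(\mathcal{Y},\eta)$ an $(n,m)$-voltage operator. Let $\tau\in\mathrm{Aut}(\mathcal{Y})$ be such that there exists a group homomorphism $\tau_\#:\mathrm{Mon}(\mathcal{X})\to\mathrm{Mon}(\mathcal{X})$ with $\tau_\#(\overline{\eta(W)})=\overline{\eta(W\tau)}$ for every $W\in\Pi(\mathcal{Y})$. Suppose that $\mathcal{X}$ is isomorphic to $\mathcal{X}_{\tau_\#}$. Then $\tau$ lifts to $\mathcal{X}\rtimes_\eta\mathcal{Y}$.
   Context: A graph may have multiple edges and semi-edges. An $n$-premaniplex is such a graph with edges coloured by $\{0,\dots,n-1\}$ so that every vertex (flag) is the starting point of exactly one dart of each colour, and whenever $|i-j|\ge2$ every alternating path of length 4 with colours $i,j$ is closed; $x^i$ is the end of the $i$-dart at $x$. $\mathcal{C}^n=\langle r_0,\dots,r_{n-1}\mid r_i^2=1,\ (r_ir_j)^2=1\ (|i-j|\ge2)\rangle$ acts on the left on flags by $r_ix=x^i$; $\mathrm{Mon}(\mathcal{X})$ is the permutation group of the flags of $\mathcal{X}$ induced by this action, and $\overline{\omega}\in\mathrm{Mon}(\mathcal{X})$ denotes the image of $\omega\in\mathcal{C}^n$. Isomorphisms are bijections of flags preserving all $i$-adjacencies; automorphisms act on the right and $\tau\in\mathrm{Aut}(\mathcal{Y})$ maps each path $W$ to a path $W\tau$. For a flag $y$ of an $m$-premaniplex $\mathcal{Y}$ and $\omega\in\mathcal{C}^m$, $P_\omega(y)$ is the homotopy class of paths from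 $y$ whose successive colours $i_1,\dots,i_k$ satisfy $r_{i_k}\cdots r_{i_1}=\omega$ (homotopic iff same start and same element of $\mathcal{C}^m$); these form the fundamental groupoid $\Pi(\mathcal{Y})$. A voltage assignment $\eta:\Pi(\mathcal{Y})\to\mathcal{C}^n$ satisfies $\eta(W_1W_2)=\eta(W_2)\eta(W_1)$; $(\mathcal{Y},\eta)$ is an $(n,m)$-voltage operator. $\mathcal{X}\rtimes_\eta\mathcal{Y}$ is the $m$-premaniplex with flags $\mathcal{X}\times\mathcal{Y}$ and $(x,y)^i=(\eta(P_{r_i}(y))x,y^i)$. $\mathcal{X}_{\tau_\#}$ is the premaniplex with the same flags as $\mathcal{X}$ and $i$-adjacency $x\mapsto\tau_\#(\overline{r_i})x$. $\tau$ lifts to $\mathcal{X}\rtimes_\eta\mathcal{Y}$ if there is an automorphism $\tilde\tau$ of $\mathcal{X}\rtimes_\eta\mathcal{Y}$ such that for every flag $(x,y)$ the second coordinate of $(x,y)\tilde\tau$ is $y\tau$. Standing assumption: $\mathcal{Y}$ has a spanning tree (forest if disconnected) all of whose darts have trivial voltage. -}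

module Defs where

open import Data.Nat using (ℕ; _≤_; _+_)
open import Data.Fin using (Fin; toℕ)
open import Data.List using (List; []; _∷_; _++_)
open import Data.Unit using (⊤)
open import Data.Product using (Σ; _×_; _,_; proj₁; proj₂)
open import Data.Sum using (_⊎_)
open import Data.Empty using (⊥)
open import Relation.Binary.PropositionalEquality using (_≡_)

-- Words in the generators r_0 … r_{n-1}.
-- The list  a₁ ∷ a₂ ∷ … ∷ aₖ ∷ []  denotes the product  r_{a₁} r_{a₂} ⋯ r_{aₖ}.

Word : ℕ → Set
Word n = List (Fin n)

Far : ∀ {n} → Fin n → Fin n → Set
Far i j = (2 + toℕ i ≤ toℕ j) ⊎ (2 + toℕ j ≤ toℕ i)

-- Equality in the Coxeter group C^n = ⟨ r_i | r_i² , (r_i r_j)² for |i-j|≥2 ⟩: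
-- the congruence on words generated by the defining relations.
data _≈C_ {n : ℕ} : Word n → Word n → Set where
  C-refl  : ∀ {u} → u ≈C u
  C-sym   : ∀ {u v} → u ≈C v → v ≈C u
  C-trans : ∀ {u v w} → u ≈C v → v ≈C w → u ≈C w
  C-cong  : ∀ {u u' v v'} → u ≈C u' → v ≈C v' → (u ++ v) ≈C (u' ++ v')
  C-inv   : ∀ i → (i ∷ i ∷ []) ≈C []
  C-comm  : ∀ i j → Far i j → (i ∷ j ∷ i ∷ j ∷ []) ≈C []

-- Edge-coloured graphs in which every vertex (flag) is the start of exactly
-- one dart of each colour: given by the map x ↦ x^i for each colour i.

record ColGraph (n : ℕ) : Set₁ where
  field
    Flag : Set
    adj  : Fin n → Flag → Flag

record Premaniplex (n : ℕ) : Set₁ where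
  field
    graph : ColGraph n
  open ColGraph graph public
  field
    adj-invol : ∀ i x → adj i (adj i x) ≡ x
    adj-comm  : ∀ i j → Far i j → ∀ x → adj i (adj j (adj i (adj j x))) ≡ x

open ColGraph public

act : ∀ {n} (G : ColGraph n) → Word n → Flag G → Flag G
act G []      x = x
act G (a ∷ w) x = adj G a (act G w x)

record IsIso {n} (G H : ColGraph n) (φ : Flag G → Flag H) : Set where
  field
    inv      : Flag H → Flag G
    inv-left : ∀ x → inv (φ x) ≡ x
    inv-right : ∀ y → φ (inv y) ≡ y
    preserve : ∀ i x → φ (adj G i x) ≡ adj H i (φ x)

IsAut : ∀ {n} (G : ColGraph n) → (Flag G → Flag G) → Set
IsAut G τ = IsIso G G τ

-- Monodromy group Mon(X), presented as the setoid of words of C^n modulo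
-- "induce the same permutation of the flags of X".  Group product = _++_.

_≈M[_]_ : ∀ {n} → Word n → Premaniplex n → Word n → Set
ω ≈M[ X ] ω' = ∀ x → act (Premaniplex.graph X) ω x ≡ act (Premaniplex.graph X) ω' x

-- A group homomorphism Mon(X) → Mon(X), given on representatives.
record IsMonHom {n} (X : Premaniplex n) (f : Word n → Word n) : Set where
  field
    resp : ∀ ω ω' → ω ≈M[ X ] ω' → f ω ≈M[ X ] f ω'
    hom  : ∀ ω ω' → f (ω ++ ω') ≈M[ X ] (f ω ++ f ω')

-- Fundamental groupoid Π(Y): the homotopy class P_ω(y) of paths starting at
-- y is represented by the pair (y , ω) with ω ∈ C^m (a word); its end flag is
-- ω y.  Concatenation: (y , ω₁)(ω₁ y , ω₂) = (y , ω₂ ω₁).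

record IsVoltage {n m} (Y : Premaniplex m) (η : Flag (Premaniplex.graph Y) → Word m → Word n) : Set where
  field
    well-def : ∀ y ω ω' → ω ≈C ω' → η y ω ≈C η y ω'
    concat   : ∀ y ω₁ ω₂ →
      η y (ω₂ ++ ω₁) ≈C (η (act (Premaniplex.graph Y) ω₁ y) ω₂ ++ η y ω₁)

-- A forest is given by a set T of darts (y , i) (the i-dart starting at y),
-- closed under reversal.  A T-walk from y is a list of colours (in order of
-- traversal) each of whose darts lies in T.

module _ {m} (G : ColGraph m) (T : Flag G → Fin m → Set) where

  walkEnd : Flag G → List (Fin m) → Flag G
  walkEnd y []       = y
  walkEnd y (c ∷ cs) = walkEnd (adj G c y) cs

  InT : Flag G → List (Fin m) → Set
  InT y []       = ⊤
  InT y (c ∷ cs) = T y c × InT (adj G c y) cs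

  NonBacktracking : List (Fin m) → Set
  NonBacktracking []            = ⊤
  NonBacktracking (c ∷ [])      = ⊤
  NonBacktracking (c ∷ d ∷ cs)  = (c ≡ d → ⊥) × NonBacktracking (d ∷ cs)

  record IsSpanningForest : Set where
    field
      symmetric : ∀ y i → T y i → T (adj G i y) i
      acyclic   : ∀ y c cs → InT y (c ∷ cs) → NonBacktracking (c ∷ cs) →
                  walkEnd y (c ∷ cs) ≡ y → ⊥
      spanning  : ∀ y cs → Σ (List (Fin m)) (λ ds → InT y ds × (walkEnd y ds ≡ walkEnd y cs))

HasTrivialSpanningForest : ∀ {n m} (Y : Premaniplex m) →
  (Flag (Premaniplex.graph Y) → Word m → Word n) → Set₁
HasTrivialSpanningForest {n} {m} Y η =
  Σ (Flag (Premaniplex.graph Y) → Fin m → Set) λ T →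
    IsSpanningForest (Premaniplex.graph Y) T ×
    (∀ y i → T y i → η y (i ∷ []) ≈C [])

semidirect : ∀ {n m} (X : Premaniplex n) (Y : Premaniplex m) →
  (Flag (Premaniplex.graph Y) → Word m → Word n) → ColGraph m
semidirect X Y η = record
  { Flag = Flag (Premaniplex.graph X) × Flag (Premaniplex.graph Y)
  ; adj  = λ i p → act (Premaniplex.graph X) (η (proj₂ p) (i ∷ [])) (proj₁ p)
                 , adj (Premaniplex.graph Y) i (proj₂ p)
  }

twist : ∀ {n} (X : Premaniplex n) → (Word n → Word n) → ColGraph n
twist X f = record
  { Flag = Flag (Premaniplex.graph X)
  ; adj  = λ i x → act (Premaniplex.graph X) (f (i ∷ [])) x
  }

Lifts : ∀ {n m} (X : Premaniplex n) (Y : Premaniplex m) →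
  (Flag (Premaniplex.graph Y) → Word m → Word n) →
  (Flag (Premaniplex.graph Y) → Flag (Premaniplex.graph Y)) → Set
Lifts X Y η τ =
  Σ (Flag (semidirect X Y η) → Flag (semidirect X Y η)) λ τ̃ →
    IsAut (semidirect X Y η) τ̃ × (∀ p → proj₂ (τ̃ p) ≡ τ (proj₂ p))

-- The lift is τ̃ (x , y) = (φ x , τ y), where φ : X ≅ X_{τ#}.  Since φ turns the
-- adjacency of X into the twisted one, φ (ω x) = τ#(ω) φ(x) for every word ω;
-- applied to ω = η(P_{r_i}(y)) and combined with τ#(η(W)) = η(Wτ) this is exactly
-- the statement that τ̃ preserves i-adjacency in X ⋊_η Y.
module Submission where

open import Defs
open import Data.Nat using (ℕ)
open import Data.List using ([]; _∷_; _++_)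
open import Data.Product using (Σ; _,_; proj₁; proj₂)
open import Relation.Binary.PropositionalEquality using (_≡_; refl; sym; trans; cong; cong₂; module ≡-Reasoning)

act-++ : ∀ {n} (G : ColGraph n) u v x → act G (u ++ v) x ≡ act G u (act G v x)
act-++ G []      v x = refl
act-++ G (a ∷ u) v x = cong (adj G a) (act-++ G u v x)

module _ {n : ℕ} (X : Premaniplex n) where
  open Premaniplex X using (graph; adj-invol)

  unact : Word n → Flag graph → Flag graph
  unact []      x = x
  unact (a ∷ w) x = unact w (adj graph a x)

  unact-act : ∀ w x → unact w (act graph w x) ≡ x
  unact-act []      x = refl
  unact-act (a ∷ w) x = trans (cong (unact w) (adj-invol a (act graph w x))) (unact-act w x)

  act-injective : ∀ w {x x'} → act graph w x ≡ act graph w x' → x ≡ x'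
  act-injective w {x} {x'} eq = begin
    x                           ≡⟨ sym (unact-act w x) ⟩
    unact w (act graph w x)     ≡⟨ cong (unact w) eq ⟩
    unact w (act graph w x')    ≡⟨ unact-act w x' ⟩
    x'                          ∎
    where open ≡-Reasoning

  monHom-[] : ∀ {f} → IsMonHom X f → f [] ≈M[ X ] []
  monHom-[] {f} hom x = sym (act-injective (f []) (begin
    act graph (f []) x                     ≡⟨ IsMonHom.hom hom [] [] x ⟩
    act graph (f [] ++ f []) x             ≡⟨ act-++ graph (f []) (f []) x ⟩
    act graph (f []) (act graph (f []) x)  ∎))
    where open ≡-Reasoning

  twistIso-act : ∀ {f φ} → IsMonHom X f → IsIso graph (twist X f) φ →
                 ∀ ω x → φ (act graph ω x) ≡ act graph (f ω) (φ x)
  twistIso-act {f} {φ} hom iso []      x = sym (monHom-[] hom (φ x))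
  twistIso-act {f} {φ} hom iso (a ∷ ω) x = begin
    φ (adj graph a (act graph ω x))               ≡⟨ IsIso.preserve iso a (act graph ω x) ⟩
    act graph (f (a ∷ [])) (φ (act graph ω x))    ≡⟨ cong (act graph (f (a ∷ []))) (twistIso-act hom iso ω x) ⟩
    act graph (f (a ∷ [])) (act graph (f ω) (φ x)) ≡⟨ sym (act-++ graph (f (a ∷ [])) (f ω) (φ x)) ⟩
    act graph (f (a ∷ []) ++ f ω) (φ x)           ≡⟨ sym (IsMonHom.hom hom (a ∷ []) ω (φ x)) ⟩
    act graph (f (a ∷ ω)) (φ x)                   ∎
    where open ≡-Reasoning

module _ {n m : ℕ} (X : Premaniplex n) (Y : Premaniplex m)
         (η : Flag (Premaniplex.graph Y) → Word m → Word n) where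
  private
    GX = Premaniplex.graph X
    GY = Premaniplex.graph Y

  product-isAut : (φ : Flag GX → Flag GX) {φ⁻¹ : Flag GX → Flag GX} (τ : Flag GY → Flag GY) →
    (∀ x → φ⁻¹ (φ x) ≡ x) → (∀ x → φ (φ⁻¹ x) ≡ x) → IsAut GY τ →
    (∀ i x y → φ (act GX (η y (i ∷ [])) x) ≡ act GX (η (τ y) (i ∷ [])) (φ x)) →
    IsAut (semidirect X Y η) (λ p → φ (proj₁ p) , τ (proj₂ p))
  product-isAut φ {φ⁻¹} τ φ⁻¹-φ φ-φ⁻¹ aut intertwines = record
    { inv       = λ p → φ⁻¹ (proj₁ p) , IsIso.inv aut (proj₂ p)
    ; inv-left  = λ p → cong₂ _,_ (φ⁻¹-φ (proj₁ p)) (IsIso.inv-left aut (proj₂ p))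
    ; inv-right = λ p → cong₂ _,_ (φ-φ⁻¹ (proj₁ p)) (IsIso.inv-right aut (proj₂ p))
    ; preserve  = λ i p → cong₂ _,_ (intertwines i (proj₁ p) (proj₂ p)) (IsIso.preserve aut i (proj₂ p))
    }

theorem6p5 : ∀ {n m : ℕ} (X : Premaniplex n) (Y : Premaniplex m)
    (η : Flag (Premaniplex.graph Y) → Word m → Word n) →
    IsVoltage Y η →
    HasTrivialSpanningForest Y η →
    (τ : Flag (Premaniplex.graph Y) → Flag (Premaniplex.graph Y)) →
    IsAut (Premaniplex.graph Y) τ →
    (τ# : Word n → Word n) →
    IsMonHom X τ# →
    (∀ y ω → τ# (η y ω) ≈M[ X ] η (τ y) ω) →
    Σ (Flag (Premaniplex.graph X) → Flag (Premaniplex.graph X))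
    (λ φ → IsIso (Premaniplex.graph X) (twist X τ#) φ) →
    Lifts X Y η τ
theorem6p5 X Y η _ _ τ aut τ# hom compatible (φ , iso) =
  (λ p → φ (proj₁ p) , τ (proj₂ p)) ,
  product-isAut X Y η φ τ (IsIso.inv-left iso) (IsIso.inv-right iso) aut intertwines ,
  λ _ → refl
  where
  intertwines : ∀ i x y → φ (act (Premaniplex.graph X) (η y (i ∷ [])) x)
                        ≡ act (Premaniplex.graph X) (η (τ y) (i ∷ [])) (φ x)
  intertwines i x y = trans (twistIso-act X hom iso (η y (i ∷ [])) x) (compatible y (i ∷ []) (φ x))
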